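{- Let $n\ge1$, $\lambda=(n,n)$, and let $\mu = 1^{\mu_1}2^{\mu_2}\cdots$ be a content with $\sum_k\mu_k = 2n$. (1) If $\mu_k>2$ for some $k$, then $|S_i(\lambda,\mu)|=0$ for all $i\ge0$. (2) If $\mu_k = 2$ for exactly $m$ values of $k$ and $\mu_k=1$ for the remaining $2n-2m$ values of $k$ (the values with positive multiplicity), then for every $i\ge 0$ $$|S_i(\lambda,\mu)| = \sum_{j_1+\cdots+j_i = n-m} C_{j_1}C_{j_2}\cdots C_{j_i} \; + \sum_{l_1+\cdots+l_{i+1}=n-m} C_{l_1}C_{l_2}\cdots C_{l_{i+1}},$$ where $C_j=\frac{1}{j+1}\binom{2j}{j}$ is the $j$-th Catalan number and the sums run over all ordered partitions of $n-m$ into exactly $i$, respectively $i+1$, positive parts (the empty ordered partition of $0$ contributing $1$).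
   Context: A row-standard tableau of shape $(n,n)$ is a filling of a $2\times n$ array of boxes by positive integers strictly increasing from left to right along each row (no condition on columns). It has content $1^{\mu_1}2^{\mu_2}\cdots$ if exactly $\mu_k$ boxes contain $k$. Inversions: take two boxes in the same column with entries $i$ and $j$. Let $i_1,i_2,\dots$ be the entries to the right of the box of $i$ in its row (read left to right) and $j_1,j_2,\dots$ those to the right of the box of $j$. Let $N\ge 0$ be the largest integer such that $i_k,j_k$ both exist and $i_k=j_k$ for all $k\le N$. The two boxes form an inversion pair if $i<j$ and either (a) at least one of $i_{N+1},j_{N+1}$ does not exist and the box of $i$ lies below the box of $j$, or (b) both exist and $i_{N+1}>j_{N+1}$. $n_{inv}(\tau)$ is the number of pairs of boxes forming inversion pairs, and $S_i(\lambda,\mu)$ is the set of row-standard tableaux of shape $\lambda$ and content $\mu$ with $n_{inv}=i$. -}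

module Defs where

open import Data.Nat using (ℕ; zero; suc; _+_; _*_; _∸_; _<_; _≤_; _<ᵇ_)
open import Data.Nat.Combinatorics using (_C_)
open import Data.Nat.DivMod using (_/_)
open import Data.Bool using (Bool; true; false; not; if_then_else_)
open import Data.Fin using (Fin)
open import Data.List using (List; []; _∷_; _++_; map; concatMap; length; filter; applyUpTo)
open import Data.Nat.ListAction using (sum; product)
open import Data.List.Relation.Unary.All using (All)
open import Data.List.Relation.Unary.Linked using (Linked)
open import Data.Maybe using (Maybe; just; nothing)
open import Data.Product using (Σ; _×_; _,_)
open import Data.Vec using (Vec; []; _∷_; toList)
open import Function.Bundles using (_↔_)
open import Relation.Binary.PropositionalEquality using (_≡_)
open import Relation.Nullary.Decidable using (⌊_⌋)
import Data.Nat.Properties as ℕₚ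

catalan : ℕ → ℕ
catalan j = ((2 * j) C j) / suc j

compositions : ℕ → ℕ → List (List ℕ)
compositions zero    zero    = [] ∷ []
compositions zero    (suc s) = []
compositions (suc k) s       =
  concatMap (λ j → map (j ∷_) (compositions k (s ∸ j))) (applyUpTo suc s)

catalanCompSum : ℕ → ℕ → ℕ
catalanCompSum k s = sum (map (λ c → product (map catalan c)) (compositions k s))

-- Contents: μ = (μ_1, μ_2, …, μ_K) as a list; μ_k = 0 for k > K.

countEq : ℕ → List ℕ → ℕ
countEq k xs = length (filter (Data.Nat._≟ k) xs)

oneTo : ℕ → List ℕ
oneTo K = applyUpTo suc K

-- Tableaux of shape (n,n): a pair (row 1, row 2) of rows of length n.
-- Row 1 is the top row, row 2 the bottom row (English convention).

Tableau : ℕ → Set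
Tableau n = Vec ℕ n × Vec ℕ n

entries : ∀ {n} → Tableau n → List ℕ
entries (r₁ , r₂) = toList r₁ ++ toList r₂

RowStandard : ∀ {n} → Tableau n → Set
RowStandard (r₁ , r₂) =
  All (1 ≤_) (toList r₁) × All (1 ≤_) (toList r₂) ×
  Linked _<_ (toList r₁) × Linked _<_ (toList r₂)

-- content μ: exactly μ_k boxes contain k, for every k ≥ 1
-- (for k ≤ K via the count list, for k > K: no entry exceeds K)
HasContent : ∀ {n} → Tableau n → List ℕ → Set
HasContent τ μ =
  map (λ k → countEq k (entries τ)) (oneTo (length μ)) ≡ μ
  × All (_≤ length μ) (entries τ)

firstDiff : List ℕ → List ℕ → Maybe (ℕ × ℕ)
firstDiff []       _        = nothing
firstDiff (_ ∷ _)  []       = nothing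
firstDiff (x ∷ xs) (y ∷ ys) = if ⌊ Data.Nat._≟_ x y ⌋ then firstDiff xs ys else just (x , y)

-- boxes with entries i (followed by is in its row) and j (followed by js),
-- where i<j is assumed; iBelow says whether the box of i is below that of j
inversionTail : Bool → List ℕ → List ℕ → Bool
inversionTail iBelow is js with firstDiff is js
... | nothing       = iBelow
... | just (a , b)  = b <ᵇ a

-- the pair of boxes in one column: top entry a (followed by as),
-- bottom entry b (followed by bs)
columnInversion : ℕ → List ℕ → ℕ → List ℕ → Bool
columnInversion a as b bs =
  if a <ᵇ b then inversionTail false as bs      -- i = a on top, j = b below
  else if b <ᵇ a then inversionTail true bs as  -- i = b below, j = a on top
  else false                                    -- equal entries: i < j fails

-- each column contains exactly one pair of boxes
ninvRows : ∀ {n} → Vec ℕ n → Vec ℕ n → ℕ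
ninvRows []       []       = 0
ninvRows (a ∷ as) (b ∷ bs) =
  (if columnInversion a (toList as) b (toList bs) then 1 else 0) + ninvRows as bs

ninv : ∀ {n} → Tableau n → ℕ
ninv (r₁ , r₂) = ninvRows r₁ r₂

S : ℕ → List ℕ → ℕ → Set
S n μ i = Σ (Tableau n) λ τ → RowStandard τ × HasContent τ μ × ninv τ ≡ i

HasCard : Set → ℕ → Set
HasCard A N = Fin N ↔ A

-- A tableau with every multiplicity at most 2 is determined by the row of each value that
-- occurs once (a value occurring twice fills both rows). Read the values from the largest
-- down, prepending each to its row: the difference of the row lengths performs a lattice
-- path that never goes below 0, and we colour each excursion by the row that is longer.
-- Each new entry is smaller than all earlier ones, so the comparison in a column is fixed
-- when the column is completed, and a column with distinct entries is an inversion exactly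
-- when its comparison differs from the first strict comparison to its right. Hence n_inv
-- is the number of colour switches, counted from the colour of the bottom row, and the
-- tableaux of shape (n, n) correspond to the closed paths with n − m down-steps. Such a
-- path is a sequence of monochrome blocks, each a nonempty Dyck path (C_l choices for l
-- down-steps); with i switches there are i + 1 blocks if the first block has the bottom
-- row's colour and i blocks otherwise.

module Submission where

open import Axiom.UniquenessOfIdentityProofs.WithK using (uip)
open import Data.Bool using (Bool; true; false; not; if_then_else_)
open import Data.Empty using (⊥-elim)
open import Data.Fin as Fin using (Fin)
open import Data.Fin.Properties using (+↔⊎; *↔×)
open import Data.List using (List; []; _∷_; _++_; length; map; concatMap; applyUpTo; filter; replicate; drop; zipWith)
open import Data.List.Properties
  using (map-++; map-cong; map-applyUpTo; ∷-injective; filter-accept; filter-reject; filter-++; length-++)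
open import Data.List.Relation.Binary.Permutation.Propositional using (_↭_; ↭-refl; ↭-sym; prep)
open import Data.List.Relation.Binary.Permutation.Propositional.Properties
  using (↭-length; filter-↭; All-resp-↭; shift)
open import Data.List.Relation.Unary.All as All using (All; []; _∷_)
open import Data.List.Relation.Unary.All.Properties using (++⁺; ++⁻ˡ; ++⁻ʳ; replicate⁺)
open import Data.List.Relation.Unary.Any as Any using (Any)
open import Data.List.Relation.Unary.Any.Properties using (map⁻)
open import Data.List.Relation.Unary.Linked as Linked using (Linked; []; [-]; _∷_)
open import Data.List.Relation.Unary.Linked.Properties using (Linked⇒All)
open import Data.Maybe using (Maybe; just; nothing)
open import Data.Nat
open import Data.Nat.Combinatorics using (_C_; nCk+nC[k+1]≡[n+1]C[k+1]; k>n⇒nCk≡0; nCk≡nC[n∸k]; nC1≡n)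
open import Data.Nat.DivMod using (_/_; m*n/n≡m)
open import Data.Nat.ListAction using (sum; product)
open import Data.Nat.ListAction.Properties using (sum-++)
open import Data.Nat.Properties
open import Algebra.Properties.CommutativeSemigroup +-commutativeSemigroup using (interchange)
open import Data.Nat.Tactic.RingSolver using (solve-∀)
open import Data.Product using (Σ; _×_; _,_; proj₁; proj₂)
open import Data.Product.Function.Dependent.Propositional using (Σ-↔)
open import Data.Product.Function.NonDependent.Propositional using (_×-↔_)
open import Data.Sum using (_⊎_; inj₁; inj₂; [_,_]′)
open import Data.Sum.Function.Propositional using (_⊎-↔_)
open import Data.Vec using (Vec; []; _∷_; toList; fromList; cast)
open import Data.Vec.Properties using (length-toList; toList-cast; toList∘fromList; fromList∘toList)
open import Function.Base using (_∘_)
open import Function.Bundles using (_↔_; mk↔ₛ′)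
open import Function.Properties.Inverse using (↔-refl; ↔-trans; ↔-sym)
import Function.Related.Propositional as Related
open import Relation.Binary.Definitions using (tri<; tri≈; tri>)
open import Relation.Binary.PropositionalEquality
open import Relation.Nullary using (¬_; yes; no)
open import Defs

-- Cardinalities and convolutions

card-empty : ∀ {A} → ¬ A → HasCard A 0
card-empty ¬a = mk↔ₛ′ (λ ()) (λ a → ⊥-elim (¬a a)) (λ a → ⊥-elim (¬a a)) (λ ())

card-contractible : ∀ {A} (a : A) → (∀ b → a ≡ b) → HasCard A 1
card-contractible a centre = mk↔ₛ′ (λ _ → a) (λ _ → Fin.zero) centre (λ { Fin.zero → refl ; (Fin.suc ()) })

card-⊎ : ∀ {A B m n} → HasCard A m → HasCard B n → HasCard (A ⊎ B) (m + n)
card-⊎ {m = m} {n} a b = ↔-trans (+↔⊎ {m} {n}) (a ⊎-↔ b)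

card-× : ∀ {A B m n} → HasCard A m → HasCard B n → HasCard (A × B) (m * n)
card-× {m = m} {n} a b = ↔-trans (*↔× {m} {n}) (a ×-↔ b)

convolution : (ℕ → ℕ) → (ℕ → ℕ) → ℕ → ℕ
convolution f g zero    = f 0 * g 0
convolution f g (suc k) = f 0 * g (suc k) + convolution (f ∘ suc) g k

convolution-unfold : ∀ f g k →
  convolution f g k ≡ f 0 * g k + sum (applyUpTo (λ a → f (suc a) * g (k ∸ suc a)) k)
convolution-unfold f g zero    = sym (+-identityʳ (f 0 * g 0))
convolution-unfold f g (suc k) = cong (f 0 * g (suc k) +_) (convolution-unfold (f ∘ suc) g k)

convolution-distribʳ-+ : ∀ f g h k →
  convolution f (λ b → g b + h b) k ≡ convolution f g k + convolution f h k
convolution-distribʳ-+ f g h zero    = *-distribˡ-+ (f 0) (g 0) (h 0)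
convolution-distribʳ-+ f g h (suc k) = begin
  f 0 * (g (suc k) + h (suc k)) + convolution (f ∘ suc) (λ b → g b + h b) k
    ≡⟨ cong₂ _+_ (*-distribˡ-+ (f 0) (g (suc k)) (h (suc k))) (convolution-distribʳ-+ (f ∘ suc) g h k) ⟩
  (f 0 * g (suc k) + f 0 * h (suc k)) + (convolution (f ∘ suc) g k + convolution (f ∘ suc) h k)
    ≡⟨ interchange (f 0 * g (suc k)) _ _ _ ⟩
  convolution f g (suc k) + convolution f h (suc k)
    ∎
  where open ≡-Reasoning

Convolution : (ℕ → Set) → (ℕ → Set) → ℕ → Set
Convolution A B k = Σ ℕ λ a → Σ ℕ λ b → (k ≡ a + b) × A a × B b

Convolution-zero : ∀ {A B} → Convolution A B 0 ↔ (A 0 × B 0)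
Convolution-zero = mk↔ₛ′ (λ { (zero , zero , refl , x , y) → x , y }) (λ (x , y) → 0 , 0 , refl , x , y)
  (λ _ → refl) (λ { (zero , zero , refl , x , y) → refl })

Convolution-suc : ∀ {A B} k → Convolution A B (suc k) ↔ ((A 0 × B (suc k)) ⊎ Convolution (A ∘ suc) B k)
Convolution-suc {A} {B} k = mk↔ₛ′ to from to∘from from∘to
  where
  to : Convolution A B (suc k) → (A 0 × B (suc k)) ⊎ Convolution (A ∘ suc) B k
  to (zero  , b , refl , x , y) = inj₁ (x , y)
  to (suc a , b , e , x , y)    = inj₂ (a , b , suc-injective e , x , y)
  from : (A 0 × B (suc k)) ⊎ Convolution (A ∘ suc) B k → Convolution A B (suc k)
  from (inj₁ (x , y))             = 0 , suc k , refl , x , y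
  from (inj₂ (a , b , e , x , y)) = suc a , b , cong suc e , x , y
  to∘from : ∀ z → to (from z) ≡ z
  to∘from (inj₁ _)                    = refl
  to∘from (inj₂ (a , b , refl , x , y)) = refl
  from∘to : ∀ z → from (to z) ≡ z
  from∘to (zero  , b , refl , x , y) = refl
  from∘to (suc a , b , refl , x , y) = refl

card-convolution : ∀ {A B f g} → (∀ a → HasCard (A a) (f a)) → (∀ b → HasCard (B b) (g b)) →
  ∀ k → HasCard (Convolution A B k) (convolution f g k)
card-convolution cardA cardB zero    = ↔-trans (card-× (cardA 0) (cardB 0)) (↔-sym Convolution-zero)
card-convolution cardA cardB (suc k) =
  ↔-trans (card-⊎ (card-× (cardA 0) (cardB (suc k))) (card-convolution (cardA ∘ suc) cardB k))
          (↔-sym (Convolution-suc k))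

-- Ballot numbers and Catalan numbers

-- Pascal's rule; _C_ is defined by factorials and division, which do not compute symbolically.
binomial : ℕ → ℕ → ℕ
binomial n       zero    = 1
binomial zero    (suc k) = 0
binomial (suc n) (suc k) = binomial n k + binomial n (suc k)

binomial≡C : ∀ n k → binomial n k ≡ n C k
binomial≡C n       zero    = refl
binomial≡C zero    (suc k) = sym (k>n⇒nCk≡0 {0} {suc k} (s≤s z≤n))
binomial≡C (suc n) (suc k) =
  trans (cong₂ _+_ (binomial≡C n k) (binomial≡C n (suc k))) (nCk+nC[k+1]≡[n+1]C[k+1] n k)

binomial-1 : ∀ n → binomial n 1 ≡ n
binomial-1 n = trans (binomial≡C n 1) (nC1≡n n)

binomial-sym : ∀ a b → binomial (a + b) a ≡ binomial (a + b) b
binomial-sym a b = begin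
  binomial (a + b) a        ≡⟨ binomial≡C (a + b) a ⟩
  (a + b) C a               ≡⟨ nCk≡nC[n∸k] (m≤m+n a b) ⟩
  (a + b) C ((a + b) ∸ a)   ≡⟨ cong ((a + b) C_) (m+n∸m≡n a b) ⟩
  (a + b) C b               ≡⟨ binomial≡C (a + b) b ⟨
  binomial (a + b) b        ∎
  where open ≡-Reasoning

binomial-absorption : ∀ n k → suc k * binomial (suc n) (suc k) ≡ suc n * binomial n k
binomial-absorption zero    zero    = refl
binomial-absorption zero    (suc k) = *-zeroʳ (suc (suc k))
binomial-absorption (suc n) zero    =
  cong suc (trans (+-identityʳ (binomial (suc n) 1))
                  (trans (binomial-1 (suc n)) (sym (*-identityʳ (suc n)))))
binomial-absorption (suc n) (suc k) = begin
  suc (suc k) * (a + d)                ≡⟨ *-distribˡ-+ (suc (suc k)) a d ⟩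
  suc (suc k) * a + suc (suc k) * d    ≡⟨ cong (suc (suc k) * a +_) (binomial-absorption n (suc k)) ⟩
  (a + suc k * a) + suc n * c          ≡⟨ cong (λ z → (a + z) + suc n * c) (binomial-absorption n k) ⟩
  (a + suc n * b) + suc n * c          ≡⟨ +-assoc a (suc n * b) (suc n * c) ⟩
  a + (suc n * b + suc n * c)          ≡⟨ cong (a +_) (*-distribˡ-+ (suc n) b c) ⟨
  a + suc n * a                        ∎
  where
  open ≡-Reasoning
  a = binomial (suc n) (suc k)
  b = binomial n k
  c = binomial n (suc k)
  d = binomial (suc n) (suc (suc k))

-- ballotCount h v counts the lattice paths from height 1 to height h with
-- v down-steps that never go below 0, by the last step taken.
ballotCount : ℕ → ℕ → ℕ
ballotCount zero    zero    = 0
ballotCount zero    (suc v) = ballotCount 1 v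
ballotCount (suc h) zero    = 1
ballotCount (suc h) (suc v) = ballotCount h (suc v) + ballotCount (suc (suc h)) v

ballotCount-1 : ∀ h → ballotCount h 1 ≡ suc h
ballotCount-1 zero    = refl
ballotCount-1 (suc h) = trans (cong (_+ 1) (ballotCount-1 h)) (+-comm (suc h) 1)

-- The number of steps of a path from 1 to h with v + 2 down-steps.
ballotLength : ℕ → ℕ → ℕ
ballotLength h v = 3 + (h + 2 * v)

-- Reflection principle: the unrestricted paths from 1 to h with v + 2
-- down-steps that touch -1 correspond to the paths from -3 to h, which
-- have v down-steps.
ballot-reflection : ∀ h v →
  ballotCount h (2 + v) + binomial (ballotLength h v) v ≡ binomial (ballotLength h v) (2 + v)
ballot-reflection zero zero = refl
ballot-reflection zero (suc v) =
  subst (λ z → B + binomial z (suc v) ≡ binomial z (3 + v)) (length-eq v) (begin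
    B + (binomial M v + binomial M (suc v))      ≡⟨ +-assoc B _ _ ⟨
    (B + binomial M v) + binomial M (suc v)      ≡⟨ cong₂ _+_ (ballot-reflection 1 v) symmetric ⟩
    binomial M (2 + v) + binomial M (3 + v)      ∎)
  where
  open ≡-Reasoning
  M = ballotLength 1 v
  B = ballotCount 1 (2 + v)
  length-eq : ∀ v → suc (3 + (1 + 2 * v)) ≡ 3 + (0 + 2 * suc v)
  length-eq = solve-∀
  M-split : ∀ v → 3 + (1 + 2 * v) ≡ suc v + (3 + v)
  M-split = solve-∀
  symmetric : binomial M (suc v) ≡ binomial M (3 + v)
  symmetric = subst (λ z → binomial z (suc v) ≡ binomial z (3 + v)) (sym (M-split v))
                    (binomial-sym (suc v) (3 + v))
ballot-reflection (suc h) zero = begin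
  (X + ballotCount (2 + h) 1) + 1        ≡⟨ cong (λ z → (X + z) + 1) (ballotCount-1 (2 + h)) ⟩
  (X + (3 + h)) + 1                      ≡⟨ rearrange X h ⟩
  (3 + h) + (X + 1)                      ≡⟨ cong₂ _+_ length-1 (ballot-reflection h 0) ⟩
  binomial L 1 + binomial L 2            ∎
  where
  open ≡-Reasoning
  X = ballotCount h 2
  L = ballotLength h 0
  rearrange : ∀ X h → (X + (3 + h)) + 1 ≡ (3 + h) + (X + 1)
  rearrange = solve-∀
  length-1 : 3 + h ≡ binomial L 1
  length-1 = sym (trans (binomial-1 L) (cong (λ z → 3 + z) (+-identityʳ h)))
ballot-reflection (suc h) (suc v) = begin
  (A + B) + (binomial L v + binomial L (suc v))      ≡⟨ swap A B (binomial L v) (binomial L (suc v)) ⟩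
  (A + binomial L (suc v)) + (B + binomial L v)      ≡⟨ cong₂ _+_ (ballot-reflection h (suc v)) shifted ⟩
  binomial L (3 + v) + binomial L (2 + v)            ≡⟨ +-comm (binomial L (3 + v)) _ ⟩
  binomial L (2 + v) + binomial L (3 + v)            ∎
  where
  open ≡-Reasoning
  L = ballotLength h (suc v)
  A = ballotCount h (3 + v)
  B = ballotCount (2 + h) (2 + v)
  length-eq : ∀ h v → 3 + (2 + h + 2 * v) ≡ 3 + (h + 2 * suc v)
  length-eq = solve-∀
  shifted : B + binomial L v ≡ binomial L (2 + v)
  shifted = subst (λ z → B + binomial z v ≡ binomial z (2 + v)) (length-eq h v)
                  (ballot-reflection (2 + h) v)
  swap : ∀ a b c d → (a + b) + (c + d) ≡ (a + d) + (b + c)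
  swap = solve-∀

-- With N = 2v + 3 the reflection principle gives ballotCount 0 (v + 2) = C(N, v+1) − C(N, v),
-- and absorption gives (v + 1) C(N, v+1) = (v + 3) C(N, v).
ballotCount-0-scaled : ∀ v → (3 + v) * ballotCount 0 (2 + v) ≡ binomial (2 * (2 + v)) (2 + v)
ballotCount-0-scaled v = begin
  (3 + v) * B                              ≡⟨ +-cancelʳ-≡ (suc v * X) _ _ scaled-difference ⟩
  X + X                                    ≡⟨ cong (X +_) middle ⟨
  X + binomial N (2 + v)                   ≡⟨ cong (λ z → binomial z (2 + v)) (double v) ⟩
  binomial (2 * (2 + v)) (2 + v)           ∎
  where
  open ≡-Reasoning
  N = ballotLength 0 v
  B = ballotCount 0 (2 + v)
  X = binomial N (suc v)
  Y = binomial N v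
  N-split : ∀ v → 3 + (0 + 2 * v) ≡ suc v + (2 + v)
  N-split = solve-∀
  double : ∀ v → suc (3 + (0 + 2 * v)) ≡ 2 * (2 + v)
  double = solve-∀
  middle : binomial N (2 + v) ≡ X
  middle = subst (λ z → binomial z (2 + v) ≡ binomial z (suc v)) (sym (N-split v))
                 (sym (binomial-sym (suc v) (2 + v)))
  difference : B + Y ≡ X
  difference = trans (ballot-reflection 0 v) middle
  ratio : suc v * X ≡ (3 + v) * Y
  ratio = +-cancelʳ-≡ (suc v * Y) _ _ (begin
    suc v * X + suc v * Y                  ≡⟨ gather v X Y ⟩
    suc v * binomial (suc N) (suc v)       ≡⟨ binomial-absorption N v ⟩
    suc N * Y                              ≡⟨ split v Y ⟩
    (3 + v) * Y + suc v * Y                ∎)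
    where
    gather : ∀ v X Y → suc v * X + suc v * Y ≡ suc v * (Y + X)
    gather = solve-∀
    split : ∀ v Y → suc (3 + (0 + 2 * v)) * Y ≡ (3 + v) * Y + suc v * Y
    split = solve-∀
  scaled-difference : (3 + v) * B + suc v * X ≡ (X + X) + suc v * X
  scaled-difference = begin
    (3 + v) * B + suc v * X                ≡⟨ cong ((3 + v) * B +_) ratio ⟩
    (3 + v) * B + (3 + v) * Y              ≡⟨ *-distribˡ-+ (3 + v) B Y ⟨
    (3 + v) * (B + Y)                      ≡⟨ cong ((3 + v) *_) difference ⟩
    (3 + v) * X                            ≡⟨ spread v X ⟩
    (X + X) + suc v * X                    ∎
    where
    spread : ∀ v X → (3 + v) * X ≡ (X + X) + suc v * X
    spread = solve-∀

ballotCount-0 : ∀ l → ballotCount 0 (suc l) ≡ catalan (suc l)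
ballotCount-0 zero    = refl
ballotCount-0 (suc v) = sym (begin
  ((2 * (2 + v)) C (2 + v)) / (3 + v)         ≡⟨ cong (_/ (3 + v)) (binomial≡C (2 * (2 + v)) (2 + v)) ⟨
  binomial (2 * (2 + v)) (2 + v) / (3 + v)    ≡⟨ cong (_/ (3 + v)) (ballotCount-0-scaled v) ⟨
  ((3 + v) * B) / (3 + v)                     ≡⟨ cong (_/ (3 + v)) (*-comm (3 + v) B) ⟩
  (B * (3 + v)) / (3 + v)                     ≡⟨ m*n/n≡m B (3 + v) ⟩
  B                                           ∎)
  where
  open ≡-Reasoning
  B = ballotCount 0 (2 + v)

catalan⁺ : ℕ → ℕ
catalan⁺ zero    = 0
catalan⁺ (suc l) = catalan (suc l)

data Ballot : ℕ → ℕ → Set where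
  start : Ballot 1 0
  rise  : ∀ {h v} → Ballot h v → Ballot (suc h) v
  fall  : ∀ {h v} → Ballot (suc h) v → Ballot h (suc v)

ballot-straight : ∀ h → Ballot (suc h) 0
ballot-straight zero    = start
ballot-straight (suc h) = rise (ballot-straight h)

ballot-straight-unique : ∀ h (b : Ballot (suc h) 0) → ballot-straight h ≡ b
ballot-straight-unique zero    start           = refl
ballot-straight-unique zero    (rise ())
ballot-straight-unique (suc h) (rise b)        = cong rise (ballot-straight-unique h b)

ballot-card : ∀ h v → HasCard (Ballot h v) (ballotCount h v)
ballot-card zero    zero    = card-empty λ ()
ballot-card zero    (suc v) = ↔-trans (ballot-card 1 v)
  (mk↔ₛ′ fall (λ { (fall b) → b }) (λ { (fall b) → refl }) (λ _ → refl))
ballot-card (suc h) zero    = card-contractible (ballot-straight h) (ballot-straight-unique h)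
ballot-card (suc h) (suc v) = ↔-trans (card-⊎ (ballot-card h (suc v)) (ballot-card (suc (suc h)) v))
  (mk↔ₛ′ [ rise , fall ]′ (λ { (rise b) → inj₁ b ; (fall b) → inj₂ b })
         (λ { (rise b) → refl ; (fall b) → refl }) (λ { (inj₁ b) → refl ; (inj₂ b) → refl }))

ballot-card-0 : ∀ v → HasCard (Ballot 0 v) (catalan⁺ v)
ballot-card-0 zero    = ballot-card 0 0
ballot-card-0 (suc l) = subst (HasCard (Ballot 0 (suc l))) (ballotCount-0 l) (ballot-card 0 (suc l))

compositionWeight : List ℕ → ℕ
compositionWeight c = product (map catalan c)

sum-concatMap : ∀ {A : Set} (g : A → List (List ℕ)) xs →
  sum (map compositionWeight (concatMap g xs)) ≡ sum (map (λ x → sum (map compositionWeight (g x))) xs)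
sum-concatMap g []       = refl
sum-concatMap g (x ∷ xs) = begin
  sum (map compositionWeight (g x ++ concatMap g xs))
    ≡⟨ cong sum (map-++ compositionWeight (g x) (concatMap g xs)) ⟩
  sum (map compositionWeight (g x) ++ map compositionWeight (concatMap g xs))
    ≡⟨ sum-++ (map compositionWeight (g x)) _ ⟩
  sum (map compositionWeight (g x)) + sum (map compositionWeight (concatMap g xs))
    ≡⟨ cong (sum (map compositionWeight (g x)) +_) (sum-concatMap g xs) ⟩
  sum (map (λ x → sum (map compositionWeight (g x))) (x ∷ xs))
    ∎
  where open ≡-Reasoning

sum-weight-cons : ∀ l cs → sum (map compositionWeight (map (l ∷_) cs)) ≡ catalan l * sum (map compositionWeight cs)
sum-weight-cons l []       = sym (*-zeroʳ (catalan l))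
sum-weight-cons l (c ∷ cs) =
  trans (cong (catalan l * compositionWeight c +_) (sum-weight-cons l cs))
        (sym (*-distribˡ-+ (catalan l) (compositionWeight c) _))

-- The first part l of a composition contributes the factor C_l.
catalanCompSum-suc : ∀ j k → catalanCompSum (suc j) k ≡ convolution catalan⁺ (catalanCompSum j) k
catalanCompSum-suc j k = begin
  catalanCompSum (suc j) k
    ≡⟨ sum-concatMap (λ l → map (l ∷_) (compositions j (k ∸ l))) (applyUpTo suc k) ⟩
  sum (map (λ l → sum (map compositionWeight (map (l ∷_) (compositions j (k ∸ l))))) (applyUpTo suc k))
    ≡⟨ cong sum (map-cong (λ l → sum-weight-cons l (compositions j (k ∸ l))) (applyUpTo suc k)) ⟩
  sum (map (λ l → catalan l * catalanCompSum j (k ∸ l)) (applyUpTo suc k))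
    ≡⟨ cong sum (map-applyUpTo suc (λ l → catalan l * catalanCompSum j (k ∸ l)) k) ⟩
  sum (applyUpTo (λ a → catalan (suc a) * catalanCompSum j (k ∸ suc a)) k)
    ≡⟨ convolution-unfold catalan⁺ (catalanCompSum j) k ⟨
  convolution catalan⁺ (catalanCompSum j) k
    ∎
  where open ≡-Reasoning

-- Coloured paths

switch : Bool → Bool → ℕ
switch false false = 0
switch true  true  = 0
switch false true  = 1
switch true  false = 1

switch-same : ∀ σ i → i ≡ switch σ σ + i
switch-same false i = refl
switch-same true  i = refl

switch-comm : ∀ a b → switch a b ≡ switch b a
switch-comm false false = refl
switch-comm false true  = refl
switch-comm true  false = refl
switch-comm true  true  = refl

-- Lattice paths from height 0 never going below 0 (the index h is the final height,
-- v the number of down-steps); every excursion away from 0 carries a colour, and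
-- i counts the colour switches along the path, starting from colour false.
data ColouredPath : ℕ → ℕ → Bool → ℕ → Set where
  nil  : ColouredPath 0 0 false 0
  lift : ∀ {v σ i j} (σ′ : Bool) → ColouredPath 0 v σ i → j ≡ switch σ σ′ + i → ColouredPath 1 v σ′ j
  up   : ∀ {h v σ i} → ColouredPath (suc h) v σ i → ColouredPath (suc (suc h)) v σ i
  down : ∀ {h v σ i} → ColouredPath (suc h) v σ i → ColouredPath h (suc v) σ i

-- What precedes the final run of one colour: either a switch out of a
-- closed path of the other colour, or nothing (the run then has colour false).
BeforeLastRun : ℕ → Bool → ℕ → Set
BeforeLastRun v σ i =
  (Σ Bool λ σ₀ → Σ ℕ λ i₀ → (σ ≡ not σ₀) × (i ≡ suc i₀) × ColouredPath 0 v σ₀ i₀)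
  ⊎ (v ≡ 0 × σ ≡ false × i ≡ 0)

-- The final run is a ballot path: after its first step it may return to 0, but
-- it does not switch colour.
LastRunDecomposition : ℕ → ℕ → Bool → ℕ → Set
LastRunDecomposition h v σ i =
  (h ≡ 0 × v ≡ 0 × σ ≡ false × i ≡ 0)
  ⊎ (Σ ℕ λ v₁ → Σ ℕ λ v₀ → (v ≡ v₁ + v₀) × Ballot h v₁ × BeforeLastRun v₀ σ i)

liftIntoLastRun : ∀ {v σ i} → BeforeLastRun v σ i → ColouredPath 1 v σ i
liftIntoLastRun (inj₁ (false , _ , refl , e , p)) = lift true p e
liftIntoLastRun (inj₁ (true  , _ , refl , e , p)) = lift false p e
liftIntoLastRun (inj₂ (refl , refl , e))          = lift false nil e

followBallot : ∀ {h v₁ v₀ σ i} → Ballot h v₁ → ColouredPath 1 v₀ σ i → ColouredPath h (v₁ + v₀) σ i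
followBallot start                 p = p
followBallot {σ = σ} {i} (rise {h = zero} b) p = lift σ (followBallot b p) (switch-same σ i)
followBallot (rise {h = suc h} b)  p = up (followBallot b p)
followBallot (fall b)              p = down (followBallot b p)

assemble : ∀ {h v σ i} → LastRunDecomposition h v σ i → ColouredPath h v σ i
assemble (inj₁ (refl , refl , refl , refl))  = nil
assemble (inj₂ (_ , _ , refl , b , before)) = followBallot b (liftIntoLastRun before)

decompose-up : ∀ {h v σ i} → LastRunDecomposition (suc h) v σ i → LastRunDecomposition (suc (suc h)) v σ i
decompose-up (inj₂ (v₁ , v₀ , e , b , before)) = inj₂ (v₁ , v₀ , e , rise b , before)

decompose-down : ∀ {h v σ i} → LastRunDecomposition (suc h) v σ i → LastRunDecomposition h (suc v) σ i
decompose-down (inj₂ (v₁ , v₀ , e , b , before)) = inj₂ (suc v₁ , v₀ , cong suc e , fall b , before)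

decompose-lift : ∀ {v σ₀ i₀ j} (σ′ : Bool) → ColouredPath 0 v σ₀ i₀ → LastRunDecomposition 0 v σ₀ i₀ →
  j ≡ switch σ₀ σ′ + i₀ → LastRunDecomposition 1 v σ′ j
decompose-lift false p (inj₁ (refl , refl , refl , refl)) e =
  inj₂ (0 , 0 , refl , start , inj₂ (refl , refl , e))
decompose-lift true  p (inj₁ (refl , refl , refl , refl)) e =
  inj₂ (0 , 0 , refl , start , inj₁ (false , 0 , refl , e , p))
decompose-lift {σ₀ = false} false p (inj₂ (v₁ , v₀ , e , b , before)) refl =
  inj₂ (v₁ , v₀ , e , rise b , before)
decompose-lift {σ₀ = true}  true  p (inj₂ (v₁ , v₀ , e , b , before)) refl =
  inj₂ (v₁ , v₀ , e , rise b , before)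
decompose-lift {v} {true}  {i₀} false p (inj₂ _) e = inj₂ (0 , v , refl , start , inj₁ (true , i₀ , refl , e , p))
decompose-lift {v} {false} {i₀} true  p (inj₂ _) e = inj₂ (0 , v , refl , start , inj₁ (false , i₀ , refl , e , p))

decompose : ∀ {h v σ i} → ColouredPath h v σ i → LastRunDecomposition h v σ i
decompose nil           = inj₁ (refl , refl , refl , refl)
decompose (lift σ′ p e) = decompose-lift σ′ p (decompose p) e
decompose (up p)        = decompose-up (decompose p)
decompose (down p)      = decompose-down (decompose p)

assemble-decompose : ∀ {h v σ i} (p : ColouredPath h v σ i) → assemble (decompose p) ≡ p
assemble-decompose nil           = refl
assemble-decompose (lift σ′ p e) = lifted σ′ p (decompose p) e (assemble-decompose p)
  where
  lifted : ∀ {v σ₀ i₀ j} (σ′ : Bool) (p : ColouredPath 0 v σ₀ i₀) (d : LastRunDecomposition 0 v σ₀ i₀)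
    (e : j ≡ switch σ₀ σ′ + i₀) → assemble d ≡ p → assemble (decompose-lift σ′ p d e) ≡ lift σ′ p e
  lifted false p (inj₁ (refl , refl , refl , refl)) e refl = refl
  lifted true  p (inj₁ (refl , refl , refl , refl)) e _    = refl
  lifted {σ₀ = false} false p (inj₂ (_ , _ , refl , _ , _)) refl d≡p = cong (λ q → lift false q refl) d≡p
  lifted {σ₀ = true}  true  p (inj₂ (_ , _ , refl , _ , _)) refl d≡p = cong (λ q → lift true q refl) d≡p
  lifted {σ₀ = true}  false p (inj₂ (_ , _ , refl , _ , _)) e _ = refl
  lifted {σ₀ = false} true  p (inj₂ (_ , _ , refl , _ , _)) e _ = refl
assemble-decompose (up p) with decompose p | assemble-decompose p
... | inj₂ (_ , _ , refl , _ , _) | d≡p = cong up d≡p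
assemble-decompose (down p) with decompose p | assemble-decompose p
... | inj₂ (_ , _ , refl , _ , _) | d≡p = cong down d≡p

decompose-followBallot : ∀ {h v₁ v₀ σ i} (b : Ballot h v₁) (before : BeforeLastRun v₀ σ i) →
  decompose (followBallot b (liftIntoLastRun before)) ≡ inj₂ (v₁ , v₀ , refl , b , before)
decompose-followBallot start (inj₁ (false , _ , refl , refl , p)) with decompose p
... | inj₁ (refl , refl , refl , refl) = refl
... | inj₂ _                           = refl
decompose-followBallot start (inj₁ (true , _ , refl , refl , p)) with decompose p
... | inj₂ _ = refl
decompose-followBallot start (inj₂ (refl , refl , refl)) = refl
decompose-followBallot {σ = false} (rise {h = zero} b) before
  rewrite decompose-followBallot b before = refl
decompose-followBallot {σ = true}  (rise {h = zero} b) before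
  rewrite decompose-followBallot b before = refl
decompose-followBallot (rise {h = suc h} b) before rewrite decompose-followBallot b before = refl
decompose-followBallot (fall b) before rewrite decompose-followBallot b before = refl

decompose-assemble : ∀ {h v σ i} (d : LastRunDecomposition h v σ i) → decompose (assemble d) ≡ d
decompose-assemble (inj₁ (refl , refl , refl , refl))  = refl
decompose-assemble (inj₂ (_ , _ , refl , b , before)) = decompose-followBallot b before

lastRun-↔ : ∀ {h v σ i} → ColouredPath h v σ i ↔ LastRunDecomposition h v σ i
lastRun-↔ = mk↔ₛ′ decompose assemble decompose-assemble assemble-decompose

ClosedPath : ℕ → ℕ → Set
ClosedPath k i = Σ Bool λ σ → ColouredPath 0 k σ i

PrefixOfRun : ℕ → ℕ → Set
PrefixOfRun v i = (Σ ℕ λ i₀ → (i ≡ suc i₀) × ClosedPath v i₀) ⊎ (v ≡ 0 × i ≡ 0)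

-- The last run of a closed path is a Dyck path, a ballot path from 1 to 0 after its first
-- step; before it comes either nothing or a closed path of the other colour and one
-- switch fewer.
closedPath-↔ : ∀ k i → ClosedPath k i ↔ ((k ≡ 0 × i ≡ 0) ⊎ Convolution (Ballot 0) (λ v → PrefixOfRun v i) k)
closedPath-↔ k i = ↔-trans (Σ-↔ ↔-refl lastRun-↔) (mk↔ₛ′ to from to∘from from∘to)
  where
  to : (Σ Bool λ σ → LastRunDecomposition 0 k σ i) → _
  to (_ , inj₁ (_ , k≡0 , _ , i≡0))                                  = inj₁ (k≡0 , i≡0)
  to (_ , inj₂ (v₁ , v₀ , e , b , inj₁ (σ₀ , i₀ , _ , i≡ , p))) =
    inj₂ (v₁ , v₀ , e , b , inj₁ (i₀ , i≡ , σ₀ , p))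
  to (_ , inj₂ (v₁ , v₀ , e , b , inj₂ (v₀≡0 , _ , i≡0))) =
    inj₂ (v₁ , v₀ , e , b , inj₂ (v₀≡0 , i≡0))
  from : _ → Σ Bool λ σ → LastRunDecomposition 0 k σ i
  from (inj₁ (k≡0 , i≡0))                                  = false , inj₁ (refl , k≡0 , refl , i≡0)
  from (inj₂ (v₁ , v₀ , e , b , inj₁ (i₀ , i≡ , σ₀ , p))) =
    not σ₀ , inj₂ (v₁ , v₀ , e , b , inj₁ (σ₀ , i₀ , refl , i≡ , p))
  from (inj₂ (v₁ , v₀ , e , b , inj₂ (v₀≡0 , i≡0))) =
    false , inj₂ (v₁ , v₀ , e , b , inj₂ (v₀≡0 , refl , i≡0))
  to∘from : ∀ z → to (from z) ≡ z
  to∘from (inj₁ _)                        = refl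
  to∘from (inj₂ (_ , _ , _ , _ , inj₁ _)) = refl
  to∘from (inj₂ (_ , _ , _ , _ , inj₂ _)) = refl
  from∘to : ∀ z → from (to z) ≡ z
  from∘to (_ , inj₁ (refl , _ , refl , _))                        = refl
  from∘to (_ , inj₂ (_ , _ , _ , _ , inj₁ (_ , _ , refl , _ , _))) = refl
  from∘to (_ , inj₂ (_ , _ , _ , _ , inj₂ (_ , refl , _)))         = refl

card-≡0 : ∀ k → HasCard (k ≡ 0) (catalanCompSum 0 k)
card-≡0 zero    = card-contractible refl λ { refl → refl }
card-≡0 (suc k) = card-empty λ ()

closedPath-card : ∀ i k → HasCard (ClosedPath k i) (catalanCompSum i k + catalanCompSum (suc i) k)
closedPath-card zero k =
  subst (HasCard (ClosedPath k 0)) (cong (catalanCompSum 0 k +_) (sym (catalanCompSum-suc 0 k)))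
        (↔-trans (card-⊎ empty-path (card-convolution ballot-card-0 prefix k)) (↔-sym (closedPath-↔ k 0)))
  where
  empty-path : HasCard (k ≡ 0 × 0 ≡ 0) (catalanCompSum 0 k)
  empty-path = ↔-trans (card-≡0 k) (mk↔ₛ′ (_, refl) proj₁ (λ { (_ , refl) → refl }) λ _ → refl)
  prefix : ∀ v → HasCard (PrefixOfRun v 0) (catalanCompSum 0 v)
  prefix v = ↔-trans (card-≡0 v)
    (mk↔ₛ′ (λ e → inj₂ (e , refl)) (λ { (inj₁ (_ , () , _)) ; (inj₂ (e , _)) → e })
           (λ { (inj₁ (_ , () , _)) ; (inj₂ (_ , refl)) → refl }) λ _ → refl)
closedPath-card (suc i) k =
  subst (HasCard (ClosedPath k (suc i))) count
        (↔-trans (card-⊎ (card-empty λ { (_ , ()) }) (card-convolution ballot-card-0 prefix k))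
                 (↔-sym (closedPath-↔ k (suc i))))
  where
  prefix : ∀ v → HasCard (PrefixOfRun v (suc i)) (catalanCompSum i v + catalanCompSum (suc i) v)
  prefix v = ↔-trans (closedPath-card i v)
    (mk↔ₛ′ (λ c → inj₁ (i , refl , c)) (λ { (inj₁ (_ , refl , c)) → c ; (inj₂ (_ , ())) })
           (λ { (inj₁ (_ , refl , _)) → refl ; (inj₂ (_ , ())) }) λ _ → refl)
  count : convolution catalan⁺ (λ v → catalanCompSum i v + catalanCompSum (suc i) v) k
        ≡ catalanCompSum (suc i) k + catalanCompSum (suc (suc i)) k
  count = trans (convolution-distribʳ-+ catalan⁺ (catalanCompSum i) (catalanCompSum (suc i)) k)
                (sym (cong₂ _+_ (catalanCompSum-suc i k) (catalanCompSum-suc (suc i) k)))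

-- Coloured paths as words of bits

State : Set
State = ℕ × ℕ × Bool × ℕ

Path : State → Set
Path (h , v , σ , i) = ColouredPath h v σ i

size : State → ℕ
size (h , v , σ , i) = h + 2 * v

PathOfSize : ℕ → Set
PathOfSize o = Σ State λ s → (size s ≡ o) × Path s

next : Bool → State → State
next x     (zero  , v , σ     , i) = 1 , v , x , switch σ x + i
next true  (suc h , v , true  , i) = suc (suc h) , v , true , i
next false (suc h , v , false , i) = suc (suc h) , v , false , i
next true  (suc h , v , false , i) = h , suc v , false , i
next false (suc h , v , true  , i) = h , suc v , true , i

step : ∀ x s → Path s → Path (next x s)
step x     (zero  , v , σ     , i) p = lift x p refl
step true  (suc h , v , true  , i) p = up p
step false (suc h , v , false , i) p = up p
step true  (suc h , v , false , i) p = down p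
step false (suc h , v , true  , i) p = down p

size-fall : ∀ h v → h + 2 * suc v ≡ suc (suc h + 2 * v)
size-fall = solve-∀

size-next : ∀ x s → size (next x s) ≡ suc (size s)
size-next x     (zero  , v , σ     , i) = refl
size-next true  (suc h , v , true  , i) = refl
size-next false (suc h , v , false , i) = refl
size-next true  (suc h , v , false , i) = size-fall h v
size-next false (suc h , v , true  , i) = size-fall h v

extend : ∀ {o} → Bool × PathOfSize o → PathOfSize (suc o)
extend (x , s , e , p) = next x s , trans (size-next x s) (cong suc e) , step x s p

lastBit : ∀ {o} → PathOfSize (suc o) → Bool × PathOfSize o
lastBit ((_ , v , _ , _) , e , lift {σ = σ} {i} σ′ p refl) = σ′ , (0 , v , σ , i) , suc-injective e , p
lastBit ((_ , v , σ , i) , e , up {h = h} p)                = σ , (suc h , v , σ , i) , suc-injective e , p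
lastBit ((h , _ , σ , i) , e , down {v = v} p)             =
  not σ , (suc h , v , σ , i) , suc-injective (trans (sym (size-fall h v)) e) , p

PathOfSize-≡ : ∀ {o} s (e e′ : size s ≡ o) (p : Path s) → _≡_ {A = PathOfSize o} (s , e , p) (s , e′ , p)
PathOfSize-≡ s e e′ p = cong (λ e″ → s , e″ , p) (uip e e′)

extend-lastBit : ∀ {o} (q : PathOfSize (suc o)) → extend (lastBit q) ≡ q
extend-lastBit (_ , _ , lift _ _ refl)         = PathOfSize-≡ _ _ _ _
extend-lastBit ((_ , _ , true  , _) , _ , up _)   = PathOfSize-≡ _ _ _ _
extend-lastBit ((_ , _ , false , _) , _ , up _)   = PathOfSize-≡ _ _ _ _
extend-lastBit ((_ , _ , true  , _) , _ , down _) = PathOfSize-≡ _ _ _ _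
extend-lastBit ((_ , _ , false , _) , _ , down _) = PathOfSize-≡ _ _ _ _

lastBit-extend : ∀ {o} (q : Bool × PathOfSize o) → lastBit (extend q) ≡ q
lastBit-extend (x     , (zero  , _ , _     , _) , _ , _) = cong (x ,_) (PathOfSize-≡ _ _ _ _)
lastBit-extend (true  , (suc _ , _ , true  , _) , _ , _) = cong (true ,_) (PathOfSize-≡ _ _ _ _)
lastBit-extend (false , (suc _ , _ , false , _) , _ , _) = cong (false ,_) (PathOfSize-≡ _ _ _ _)
lastBit-extend (true  , (suc _ , _ , false , _) , _ , _) = cong (true ,_) (PathOfSize-≡ _ _ _ _)
lastBit-extend (false , (suc _ , _ , true  , _) , _ , _) = cong (false ,_) (PathOfSize-≡ _ _ _ _)

emptyPath : PathOfSize 0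
emptyPath = (0 , 0 , false , 0) , refl , nil

emptyPath-unique : ∀ (q : PathOfSize 0) → emptyPath ≡ q
emptyPath-unique ((zero , zero , _ , _) , refl , nil) = refl

-- Fillings of two rows

-- Filling μ v r₁ r₂: the rows r₁ (top) and r₂ (bottom) of a row-standard filling
-- in which the value v + k occurs μ_k times (μ read from k = 0), at most once per row.
data Filling : List ℕ → ℕ → List ℕ → List ℕ → Set where
  done   : ∀ {v} → Filling [] v [] []
  skip   : ∀ {μ v r₁ r₂} → Filling μ (suc v) r₁ r₂ → Filling (0 ∷ μ) v r₁ r₂
  top    : ∀ {μ v r₁ r₂} → Filling μ (suc v) r₁ r₂ → Filling (1 ∷ μ) v (v ∷ r₁) r₂
  bottom : ∀ {μ v r₁ r₂} → Filling μ (suc v) r₁ r₂ → Filling (1 ∷ μ) v r₁ (v ∷ r₂)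
  both   : ∀ {μ v r₁ r₂} → Filling μ (suc v) r₁ r₂ → Filling (2 ∷ μ) v (v ∷ r₁) (v ∷ r₂)

Rows : List ℕ → ℕ → Set
Rows μ v = Σ (List ℕ) λ r₁ → Σ (List ℕ) λ r₂ → Filling μ v r₁ r₂

-- A value occurring once contributes one bit (its row); the values are read
-- from the largest down.
toPath : ∀ {μ v r₁ r₂} → Filling μ v r₁ r₂ → PathOfSize (countEq 1 μ)
toPath done       = emptyPath
toPath (skip f)   = toPath f
toPath (top f)    = extend (true , toPath f)
toPath (bottom f) = extend (false , toPath f)
toPath (both f)   = toPath f

fromPath : ∀ μ v → All (_≤ 2) μ → PathOfSize (countEq 1 μ) → Rows μ v
fromPath []                 v []      _ = [] , [] , done
fromPath (0 ∷ μ)            v (_ ∷ a) q with fromPath μ (suc v) a q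
... | r₁ , r₂ , f = r₁ , r₂ , skip f
fromPath (1 ∷ μ)            v (_ ∷ a) q with lastBit q
... | true  , q′ with fromPath μ (suc v) a q′
...   | r₁ , r₂ , f = v ∷ r₁ , r₂ , top f
fromPath (1 ∷ μ)            v (_ ∷ a) q | false , q′ with fromPath μ (suc v) a q′
...   | r₁ , r₂ , f = r₁ , v ∷ r₂ , bottom f
fromPath (2 ∷ μ)            v (_ ∷ a) q with fromPath μ (suc v) a q
... | r₁ , r₂ , f = v ∷ r₁ , v ∷ r₂ , both f
fromPath (suc (suc (suc _)) ∷ μ) v (s≤s (s≤s ()) ∷ _) _

toPath-fromPath : ∀ μ v a (q : PathOfSize (countEq 1 μ)) → toPath (proj₂ (proj₂ (fromPath μ v a q))) ≡ q
toPath-fromPath []      v []      q = emptyPath-unique q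
toPath-fromPath (0 ∷ μ) v (_ ∷ a) q = toPath-fromPath μ (suc v) a q
toPath-fromPath (1 ∷ μ) v (_ ∷ a) q with lastBit q | extend-lastBit q
... | true  , q′ | e = trans (cong (λ q″ → extend (true , q″)) (toPath-fromPath μ (suc v) a q′)) e
... | false , q′ | e = trans (cong (λ q″ → extend (false , q″)) (toPath-fromPath μ (suc v) a q′)) e
toPath-fromPath (2 ∷ μ) v (_ ∷ a) q = toPath-fromPath μ (suc v) a q
toPath-fromPath (suc (suc (suc _)) ∷ μ) v (s≤s (s≤s ()) ∷ _) _

fromPath-toPath : ∀ {μ v r₁ r₂} (f : Filling μ v r₁ r₂) a → fromPath μ v a (toPath f) ≡ (r₁ , r₂ , f)
fromPath-toPath done       []      = refl
fromPath-toPath (skip f)   (_ ∷ a) rewrite fromPath-toPath f a = refl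
fromPath-toPath (top f)    (_ ∷ a) rewrite lastBit-extend (true , toPath f) | fromPath-toPath f a = refl
fromPath-toPath (bottom f) (_ ∷ a) rewrite lastBit-extend (false , toPath f) | fromPath-toPath f a = refl
fromPath-toPath (both f)   (_ ∷ a) rewrite fromPath-toPath f a = refl

rows-↔ : ∀ μ v → All (_≤ 2) μ → Rows μ v ↔ PathOfSize (countEq 1 μ)
rows-↔ μ v a = mk↔ₛ′ (λ (_ , _ , f) → toPath f) (fromPath μ v a) (toPath-fromPath μ v a)
  λ (_ , _ , f) → fromPath-toPath f a

filling-lowerBound : ∀ {μ v r₁ r₂} → Filling μ v r₁ r₂ → All (v ≤_) r₁ × All (v ≤_) r₂
filling-lowerBound done       = [] , []
filling-lowerBound (skip f)   with filling-lowerBound f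
... | a₁ , a₂ = All.map <⇒≤ a₁ , All.map <⇒≤ a₂
filling-lowerBound (top f)    with filling-lowerBound f
... | a₁ , a₂ = ≤-refl ∷ All.map <⇒≤ a₁ , All.map <⇒≤ a₂
filling-lowerBound (bottom f) with filling-lowerBound f
... | a₁ , a₂ = All.map <⇒≤ a₁ , ≤-refl ∷ All.map <⇒≤ a₂
filling-lowerBound (both f)   with filling-lowerBound f
... | a₁ , a₂ = ≤-refl ∷ All.map <⇒≤ a₁ , ≤-refl ∷ All.map <⇒≤ a₂

filling-length : ∀ {μ v r₁ r₂} → Filling μ v r₁ r₂ → length r₁ + length r₂ ≡ sum μ
filling-length done       = refl
filling-length (skip f)   = filling-length f
filling-length (top f)    = cong suc (filling-length f)
filling-length {r₁ = r₁} {_ ∷ r₂} (bottom f) = trans (+-suc (length r₁) (length r₂)) (cong suc (filling-length f))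
filling-length {r₁ = _ ∷ r₁} {_ ∷ r₂} (both f) =
  cong suc (trans (+-suc (length r₁) (length r₂)) (cong suc (filling-length f)))

filling-unique : ∀ {μ v r₁ r₂} (f f′ : Filling μ v r₁ r₂) → f ≡ f′
filling-unique done       done        = refl
filling-unique (skip f)   (skip f′)   = cong skip (filling-unique f f′)
filling-unique (top f)    (top f′)    = cong top (filling-unique f f′)
filling-unique (bottom f) (bottom f′) = cong bottom (filling-unique f f′)
filling-unique (both f)   (both f′)   = cong both (filling-unique f f′)
filling-unique (top f)    (bottom _)  with filling-lowerBound f
... | _ , (v<v ∷ _) = ⊥-elim (<-irrefl refl v<v)
filling-unique (bottom f) (top _)     with filling-lowerBound f
... | (v<v ∷ _) , _ = ⊥-elim (<-irrefl refl v<v)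

-- Columns and inversions

data Comparison : Set where
  LT EQ GT : Comparison

comparison : ℕ → ℕ → Comparison
comparison a b = if a <ᵇ b then LT else if b <ᵇ a then GT else EQ

<⇒<ᵇ≡true : ∀ {x y} → x < y → (x <ᵇ y) ≡ true
<⇒<ᵇ≡true {zero}  {suc y} _       = refl
<⇒<ᵇ≡true {suc x} {suc y} (s≤s p) = <⇒<ᵇ≡true p

≥⇒<ᵇ≡false : ∀ {x y} → y ≤ x → (x <ᵇ y) ≡ false
≥⇒<ᵇ≡false {x}     {zero}  _       = refl
≥⇒<ᵇ≡false {suc x} {suc y} (s≤s p) = ≥⇒<ᵇ≡false p

comparison-< : ∀ {x y} → x < y → comparison x y ≡ LT
comparison-< p rewrite <⇒<ᵇ≡true p = refl

comparison-> : ∀ {x y} → y < x → comparison x y ≡ GT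
comparison-> p rewrite ≥⇒<ᵇ≡false (<⇒≤ p) | <⇒<ᵇ≡true p = refl

comparison-≡ : ∀ x → comparison x x ≡ EQ
comparison-≡ x rewrite ≥⇒<ᵇ≡false (≤-refl {x}) = refl

-- Whether the first strict comparison is GT (none at all counts as LT).
firstGT : List Comparison → Bool
firstGT []        = false
firstGT (LT ∷ cs) = false
firstGT (GT ∷ cs) = true
firstGT (EQ ∷ cs) = firstGT cs

-- A column with distinct entries is an inversion exactly when its comparison
-- differs from the first strict comparison to its right.
columnInversions : Comparison → Bool → ℕ
columnInversions LT b = switch false b
columnInversions GT b = switch true b
columnInversions EQ b = 0

inversions : List Comparison → ℕ
inversions []       = 0
inversions (c ∷ cs) = columnInversions c (firstGT cs) + inversions cs

-- The columns of two rows aligned at their right ends.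
columns : List ℕ → List ℕ → List Comparison
columns r₁ r₂ = zipWith comparison (drop (length r₁ ∸ length r₂) r₁) (drop (length r₂ ∸ length r₁) r₂)

columns-same-length : ∀ r₁ r₂ → length r₁ ≡ length r₂ → columns r₁ r₂ ≡ zipWith comparison r₁ r₂
columns-same-length r₁ r₂ e rewrite e | n∸n≡0 (length r₂) = refl

drop-∸-suc : ∀ {P : ℕ → Set} m xs → m < length xs → All P xs →
  Σ ℕ λ y → P y × (drop (length xs ∸ suc m) xs ≡ y ∷ drop (suc (length xs ∸ suc m)) xs)
drop-∸-suc m xs m<l a = go (length xs ∸ suc m) xs (∸-monoʳ-< (s≤s z≤n) m<l) a
  where
  go : ∀ {P : ℕ → Set} k xs → k < length xs → All P xs → Σ ℕ λ y → P y × (drop k xs ≡ y ∷ drop (suc k) xs)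
  go zero    (x ∷ xs) _       (px ∷ _) = x , px , refl
  go (suc k) (x ∷ xs) (s≤s p) (_ ∷ a)  = go k xs p a

columns-∷ˡ-longer : ∀ x r₁ r₂ → length r₂ ≤ length r₁ → columns (x ∷ r₁) r₂ ≡ columns r₁ r₂
columns-∷ˡ-longer x r₁ r₂ le = cong₂ (λ a b → zipWith comparison (drop a (x ∷ r₁)) (drop b r₂))
  (+-∸-assoc 1 le) (trans (m≤n⇒m∸n≡0 (m≤n⇒m≤1+n le)) (sym (m≤n⇒m∸n≡0 le)))

columns-∷ʳ-longer : ∀ x r₁ r₂ → length r₁ ≤ length r₂ → columns r₁ (x ∷ r₂) ≡ columns r₁ r₂
columns-∷ʳ-longer x r₁ r₂ le = cong₂ (λ a b → zipWith comparison (drop a r₁) (drop b (x ∷ r₂)))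
  (trans (m≤n⇒m∸n≡0 (m≤n⇒m≤1+n le)) (sym (m≤n⇒m∸n≡0 le))) (+-∸-assoc 1 le)

columns-∷ˡ-shorter : ∀ {P : ℕ → Set} x r₁ r₂ → length r₁ < length r₂ → All P r₂ →
  Σ ℕ λ y → P y × (columns (x ∷ r₁) r₂ ≡ comparison x y ∷ columns r₁ r₂)
columns-∷ˡ-shorter x r₁ r₂ lt a with drop-∸-suc (length r₁) r₂ lt a
... | y , py , e = y , py , goal
  where
  goal : columns (x ∷ r₁) r₂ ≡ comparison x y ∷ columns r₁ r₂
  goal rewrite m≤n⇒m∸n≡0 lt | m≤n⇒m∸n≡0 (<⇒≤ lt) | +-∸-assoc 1 lt | e = refl

columns-∷ʳ-shorter : ∀ {P : ℕ → Set} x r₁ r₂ → length r₂ < length r₁ → All P r₁ →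
  Σ ℕ λ y → P y × (columns r₁ (x ∷ r₂) ≡ comparison y x ∷ columns r₁ r₂)
columns-∷ʳ-shorter x r₁ r₂ lt a with drop-∸-suc (length r₂) r₁ lt a
... | y , py , e = y , py , goal
  where
  goal : columns r₁ (x ∷ r₂) ≡ comparison y x ∷ columns r₁ r₂
  goal rewrite m≤n⇒m∸n≡0 lt | m≤n⇒m∸n≡0 (<⇒≤ lt) | +-∸-assoc 1 lt | e = refl

columns-∷-equal : ∀ x r₁ r₂ → length r₁ ≡ length r₂ →
  columns (x ∷ r₁) (x ∷ r₂) ≡ comparison x x ∷ columns r₁ r₂
columns-∷-equal x r₁ r₂ e rewrite e | n∸n≡0 (length r₂) = refl

columns-∷-topLonger : ∀ {P : ℕ → Set} x r₁ r₂ → length r₂ < length r₁ → All P r₁ →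
  Σ ℕ λ y → P y × (columns (x ∷ r₁) (x ∷ r₂) ≡ comparison y x ∷ columns r₁ r₂)
columns-∷-topLonger x r₁ r₂ lt a with drop-∸-suc (length r₂) r₁ lt a
... | y , py , e = y , py , goal
  where
  goal : columns (x ∷ r₁) (x ∷ r₂) ≡ comparison y x ∷ columns r₁ r₂
  goal rewrite m≤n⇒m∸n≡0 (<⇒≤ lt) | +-∸-assoc 1 lt | e = refl

columns-∷-bottomLonger : ∀ {P : ℕ → Set} x r₁ r₂ → length r₁ < length r₂ → All P r₂ →
  Σ ℕ λ y → P y × (columns (x ∷ r₁) (x ∷ r₂) ≡ comparison x y ∷ columns r₁ r₂)
columns-∷-bottomLonger x r₁ r₂ lt a with drop-∸-suc (length r₁) r₂ lt a
... | y , py , e = y , py , goal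
  where
  goal : columns (x ∷ r₁) (x ∷ r₂) ≡ comparison x y ∷ columns r₁ r₂
  goal rewrite m≤n⇒m∸n≡0 (<⇒≤ lt) | +-∸-assoc 1 lt | e = refl

-- How the state after reading the values records rows of lengths p (top) and
-- q (bottom) with aligned columns cs. When the rows differ in length, the next
-- column to be completed compares a new, smaller entry with one of the longer row,
-- so its comparison is already known and its inversion is already counted.
Records : State → ℕ → ℕ → List Comparison → Set
Records (zero  , v , σ     , i) p q cs = (p ≡ q) × (σ ≡ firstGT cs) × (i ≡ inversions cs)
Records (suc h , v , true  , i) p q cs = (p ≡ suc h + q) × (i ≡ switch true (firstGT cs) + inversions cs)
Records (suc h , v , false , i) p q cs = (q ≡ suc h + p) × (i ≡ switch false (firstGT cs) + inversions cs)

shorter : ∀ {h q} p → p ≡ suc h + q → q < p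
shorter {h} {q} p refl = s≤s (m≤n+m q h)

records-top : ∀ s x r₁ r₂ → All (suc x ≤_) r₂ → Records s (length r₁) (length r₂) (columns r₁ r₂) →
  Records (next true s) (suc (length r₁)) (length r₂) (columns (x ∷ r₁) r₂)
records-top (zero , v , σ , i) x r₁ r₂ _ (e , refl , refl)
  rewrite columns-∷ˡ-longer x r₁ r₂ (≤-reflexive (sym e)) =
  cong suc e , cong (_+ inversions (columns r₁ r₂)) (switch-comm (firstGT (columns r₁ r₂)) true)
records-top (suc h , v , true , i) x r₁ r₂ _ (e , ei)
  rewrite columns-∷ˡ-longer x r₁ r₂ (<⇒≤ (shorter (length r₁) e)) = cong suc e , ei
records-top (suc h , v , false , i) x r₁ r₂ a (e , ei)
  with columns-∷ˡ-shorter x r₁ r₂ (shorter (length r₂) e) a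
... | y , x<y , ec rewrite ec | comparison-< x<y with h
...   | zero   = sym e , refl , ei
...   | suc h′ = trans e (sym (+-suc (suc h′) (length r₁))) , ei

records-bottom : ∀ s x r₁ r₂ → All (suc x ≤_) r₁ → Records s (length r₁) (length r₂) (columns r₁ r₂) →
  Records (next false s) (length r₁) (suc (length r₂)) (columns r₁ (x ∷ r₂))
records-bottom (zero , v , σ , i) x r₁ r₂ _ (e , refl , refl)
  rewrite columns-∷ʳ-longer x r₁ r₂ (≤-reflexive e) =
  cong suc (sym e) , cong (_+ inversions (columns r₁ r₂)) (switch-comm (firstGT (columns r₁ r₂)) false)
records-bottom (suc h , v , false , i) x r₁ r₂ _ (e , ei)
  rewrite columns-∷ʳ-longer x r₁ r₂ (<⇒≤ (shorter (length r₂) e)) = cong suc e , ei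
records-bottom (suc h , v , true , i) x r₁ r₂ a (e , ei)
  with columns-∷ʳ-shorter x r₁ r₂ (shorter (length r₁) e) a
... | y , x<y , ec rewrite ec | comparison-> x<y with h
...   | zero   = e , refl , ei
...   | suc h′ = trans e (sym (+-suc (suc h′) (length r₂))) , ei

records-both : ∀ s x r₁ r₂ → All (suc x ≤_) r₁ → All (suc x ≤_) r₂ →
  Records s (length r₁) (length r₂) (columns r₁ r₂) →
  Records s (suc (length r₁)) (suc (length r₂)) (columns (x ∷ r₁) (x ∷ r₂))
records-both (zero , v , σ , i) x r₁ r₂ _ _ (e , refl , refl)
  rewrite columns-∷-equal x r₁ r₂ e | comparison-≡ x = cong suc e , refl , refl
records-both (suc h , v , true , i) x r₁ r₂ a₁ _ (e , ei)
  with columns-∷-topLonger x r₁ r₂ (shorter (length r₁) e) a₁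
... | y , x<y , ec rewrite ec | comparison-> x<y =
  trans (cong suc e) (sym (+-suc (suc h) (length r₂))) , ei
records-both (suc h , v , false , i) x r₁ r₂ _ a₂ (e , ei)
  with columns-∷-bottomLonger x r₁ r₂ (shorter (length r₂) e) a₂
... | y , x<y , ec rewrite ec | comparison-< x<y =
  trans (cong suc e) (sym (+-suc (suc h) (length r₁))) , ei

toPath-records : ∀ {μ v r₁ r₂} (f : Filling μ v r₁ r₂) →
  Records (proj₁ (toPath f)) (length r₁) (length r₂) (columns r₁ r₂)
toPath-records done       = refl , refl , refl
toPath-records (skip f)   = toPath-records f
toPath-records {v = v} {_ ∷ r₁} {r₂} (top f) =
  records-top (proj₁ (toPath f)) v r₁ r₂ (proj₂ (filling-lowerBound f)) (toPath-records f)
toPath-records {v = v} {r₁} {_ ∷ r₂} (bottom f) =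
  records-bottom (proj₁ (toPath f)) v r₁ r₂ (proj₁ (filling-lowerBound f)) (toPath-records f)
toPath-records {v = v} {_ ∷ r₁} {_ ∷ r₂} (both f) =
  records-both (proj₁ (toPath f)) v r₁ r₂ (proj₁ (filling-lowerBound f)) (proj₂ (filling-lowerBound f)) (toPath-records f)

countEq-↭ : ∀ k {xs ys} → xs ↭ ys → countEq k xs ≡ countEq k ys
countEq-↭ k p = ↭-length (filter-↭ (_≟ k) p)

countEq-++ : ∀ k xs ys → countEq k (xs ++ ys) ≡ countEq k xs + countEq k ys
countEq-++ k xs ys = trans (cong length (filter-++ (_≟ k) xs ys)) (length-++ (filter (_≟ k) xs))

countEq-∷-≡ : ∀ k xs → countEq k (k ∷ xs) ≡ suc (countEq k xs)
countEq-∷-≡ k xs = cong length (filter-accept (_≟ k) {k} {xs} refl)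

countEq-∷-≢ : ∀ {x k} xs → x ≢ k → countEq k (x ∷ xs) ≡ countEq k xs
countEq-∷-≢ {x} {k} xs x≢k = cong length (filter-reject (_≟ k) {x} {xs} x≢k)

countEq-> : ∀ {k} xs → All (k <_) xs → countEq k xs ≡ 0
countEq-> []       []        = refl
countEq-> (x ∷ xs) (k<x ∷ a) = trans (countEq-∷-≢ xs (λ x≡k → <-irrefl (sym x≡k) k<x)) (countEq-> xs a)

countEq-replicate-≡ : ∀ k c → countEq k (replicate c k) ≡ c
countEq-replicate-≡ k zero    = refl
countEq-replicate-≡ k (suc c) = trans (countEq-∷-≡ k (replicate c k)) (cong suc (countEq-replicate-≡ k c))

countEq-replicate-≢ : ∀ {x k} c → x ≢ k → countEq k (replicate c x) ≡ 0
countEq-replicate-≢ zero    _   = refl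
countEq-replicate-≢ (suc c) x≢k = trans (countEq-∷-≢ _ x≢k) (countEq-replicate-≢ c x≢k)

multiplicities : ℕ → ℕ → List ℕ → List ℕ
multiplicities v zero    xs = []
multiplicities v (suc K) xs = countEq v xs ∷ multiplicities (suc v) K xs

multiplicities-cong : ∀ {xs ys} v K → (∀ k → v ≤ k → countEq k xs ≡ countEq k ys) →
  multiplicities v K xs ≡ multiplicities v K ys
multiplicities-cong v zero    _ = refl
multiplicities-cong v (suc K) e =
  cong₂ _∷_ (e v ≤-refl) (multiplicities-cong (suc v) K (λ k v<k → e k (<⇒≤ v<k)))

multiplicities-prepend : ∀ {v E E′} c K → All (v <_) E → E′ ↭ replicate c v ++ E →
  multiplicities v (suc K) E′ ≡ c ∷ multiplicities (suc v) K E
multiplicities-prepend {v} {E} {E′} c K v<E p = cong₂ _∷_ head (multiplicities-cong (suc v) K above)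
  where
  counts : ∀ k → countEq k E′ ≡ countEq k (replicate c v) + countEq k E
  counts k = trans (countEq-↭ k p) (countEq-++ k (replicate c v) E)
  head : countEq v E′ ≡ c
  head = trans (counts v) (trans (cong₂ _+_ (countEq-replicate-≡ v c) (countEq-> E v<E)) (+-identityʳ c))
  above : ∀ k → suc v ≤ k → countEq k E′ ≡ countEq k E
  above k v<k = trans (counts k) (cong (_+ countEq k E) (countEq-replicate-≢ c (<⇒≢ v<k)))

record Valid (μ : List ℕ) (v : ℕ) (r₁ r₂ : List ℕ) : Set where
  field
    increasing₁ : Linked _<_ r₁
    increasing₂ : Linked _<_ r₂
    lowerBound₁ : All (v ≤_) r₁
    lowerBound₂ : All (v ≤_) r₂
    content     : multiplicities v (length μ) (r₁ ++ r₂) ≡ μ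
    upperBound  : All (_< v + length μ) (r₁ ++ r₂)

linked-∷ : ∀ {x ys} → All (x <_) ys → Linked _<_ ys → Linked _<_ (x ∷ ys)
linked-∷ []        []  = [-]
linked-∷ (x<y ∷ _) ys↑ = x<y ∷ ys↑

linked-head : ∀ {x ys} → Linked _<_ (x ∷ ys) → All (x <_) ys
linked-head [-]         = []
linked-head (x<y ∷ ys↑) = Linked⇒All <-trans x<y ys↑

countEq-increasing : ∀ x r → Linked _<_ r → countEq x r ≤ 1
countEq-increasing x []      _ = z≤n
countEq-increasing x (y ∷ r) ↑ with y ≟ x
... | yes refl = ≤-reflexive (trans (countEq-∷-≡ y r) (cong suc (countEq-> r (linked-head ↑))))
... | no y≢x   = subst (_≤ 1) (sym (countEq-∷-≢ r y≢x)) (countEq-increasing x r (Linked.tail ↑))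

no-triple-entry : ∀ {n} μ i → Any (2 <_) μ → ¬ S n μ i
no-triple-entry μ i triple ((v₁ , v₂) , (_ , _ , ↑₁ , ↑₂) , (content , _) , _) with
  Any.satisfied (map⁻ (subst (Any (2 <_)) (sym content) triple))
... | x , 2<count = <-irrefl refl (≤-trans 2<count (subst (_≤ 2) (sym (countEq-++ x (toList v₁) (toList v₂)))
                      (+-mono-≤ (countEq-increasing x (toList v₁) ↑₁) (countEq-increasing x (toList v₂) ↑₂))))

Placed : ℕ → ℕ → List ℕ → List ℕ → List ℕ → List ℕ → Set
Placed c v r₁ r₂ r₁′ r₂′ = r₁′ ++ r₂′ ↭ replicate c v ++ (r₁ ++ r₂)

bound-shift : ∀ {v K x} → x < suc v + K → x < v + suc K
bound-shift {v} {K} {x} = subst (x <_) (sym (+-suc v K))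

bound-unshift : ∀ {v K x} → x < v + suc K → x < suc v + K
bound-unshift {v} {K} {x} = subst (x <_) (+-suc v K)

valid-extend : ∀ {μ v r₁ r₂ r₁′ r₂′} c → Valid μ (suc v) r₁ r₂ → Placed c v r₁ r₂ r₁′ r₂′ →
  Linked _<_ r₁′ → Linked _<_ r₂′ → All (v ≤_) r₁′ → All (v ≤_) r₂′ → Valid (c ∷ μ) v r₁′ r₂′
valid-extend {μ} {v} c V p ↑₁ ↑₂ low₁ low₂ = record
  { increasing₁ = ↑₁ ; increasing₂ = ↑₂ ; lowerBound₁ = low₁ ; lowerBound₂ = low₂
  ; content     = trans (multiplicities-prepend c (length μ) (++⁺ lowerBound₁ lowerBound₂) p) (cong (c ∷_) content)
  ; upperBound  = All-resp-↭ (↭-sym p)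
      (++⁺ (replicate⁺ c (m<m+n v (s≤s z≤n))) (All.map bound-shift upperBound))
  }
  where open Valid V

valid-shrink : ∀ {c μ v r₁ r₂ r₁′ r₂′} c′ → Valid (c ∷ μ) v r₁ r₂ → Placed c′ v r₁′ r₂′ r₁ r₂ →
  Linked _<_ r₁′ → Linked _<_ r₂′ → All (v <_) r₁′ → All (v <_) r₂′ → c′ ≡ c × Valid μ (suc v) r₁′ r₂′
valid-shrink {c} {μ} {v} c′ V p ↑₁ ↑₂ low₁ low₂ = proj₁ heads , record
  { increasing₁ = ↑₁ ; increasing₂ = ↑₂ ; lowerBound₁ = low₁ ; lowerBound₂ = low₂
  ; content     = proj₂ heads
  ; upperBound  = All.map bound-unshift (++⁻ʳ (replicate c′ v) (All-resp-↭ p upperBound))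
  }
  where
  open Valid V
  heads = ∷-injective (trans (sym (multiplicities-prepend c′ (length μ) (++⁺ low₁ low₂) p)) content)

filling⇒valid : ∀ {μ v r₁ r₂} → Filling μ v r₁ r₂ → Valid μ v r₁ r₂
filling⇒valid done = record
  { increasing₁ = [] ; increasing₂ = [] ; lowerBound₁ = [] ; lowerBound₂ = []
  ; content = refl ; upperBound = [] }
filling⇒valid (skip f) = valid-extend 0 V ↭-refl increasing₁ increasing₂
  (All.map <⇒≤ lowerBound₁) (All.map <⇒≤ lowerBound₂)
  where V = filling⇒valid f ; open Valid V
filling⇒valid (top f) = valid-extend 1 V ↭-refl (linked-∷ lowerBound₁ increasing₁) increasing₂
  (≤-refl ∷ All.map <⇒≤ lowerBound₁) (All.map <⇒≤ lowerBound₂)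
  where V = filling⇒valid f ; open Valid V
filling⇒valid {r₁ = r₁} {_ ∷ r₂} (bottom f) = valid-extend 1 V (shift _ r₁ r₂) increasing₁
  (linked-∷ lowerBound₂ increasing₂) (All.map <⇒≤ lowerBound₁) (≤-refl ∷ All.map <⇒≤ lowerBound₂)
  where V = filling⇒valid f ; open Valid V
filling⇒valid {r₁ = _ ∷ r₁} {_ ∷ r₂} (both f) = valid-extend 2 V (prep _ (shift _ r₁ r₂))
  (linked-∷ lowerBound₁ increasing₁) (linked-∷ lowerBound₂ increasing₂)
  (≤-refl ∷ All.map <⇒≤ lowerBound₁) (≤-refl ∷ All.map <⇒≤ lowerBound₂)
  where V = filling⇒valid f ; open Valid V

data RowStart (v : ℕ) : List ℕ → Set where
  starts : ∀ {r} → All (v <_) r → Linked _<_ r → RowStart v (v ∷ r)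
  above  : ∀ {r} → All (v <_) r → Linked _<_ r → RowStart v r

rowStart : ∀ v r → Linked _<_ r → All (v ≤_) r → RowStart v r
rowStart v []      _  _          = above [] []
rowStart v (x ∷ r) ↑ (v≤x ∷ low) with v ≟ x
... | yes refl = starts (linked-head ↑) (Linked.tail ↑)
... | no v≢x   = above (v<x ∷ All.map (<-trans v<x) (linked-head ↑)) ↑
  where v<x = ≤∧≢⇒< v≤x v≢x

bounded-empty : ∀ {v xs} → All (v ≤_) xs → All (_< v + 0) xs → xs ≡ []
bounded-empty []                  _          = refl
bounded-empty {v} {x ∷ _} (v≤x ∷ _) (x<v ∷ _) =
  ⊥-elim (<-irrefl refl (<-≤-trans (subst (x <_) (+-identityʳ v) x<v) v≤x))

valid⇒filling : ∀ μ v r₁ r₂ → Valid μ v r₁ r₂ → Filling μ v r₁ r₂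
valid⇒filling [] v r₁ r₂ V
  with bounded-empty lowerBound₁ (++⁻ˡ r₁ upperBound) | bounded-empty lowerBound₂ (++⁻ʳ r₁ upperBound)
  where open Valid V
... | refl | refl = done
valid⇒filling (c ∷ μ) v r₁ r₂ V
  with rowStart v r₁ increasing₁ lowerBound₁ | rowStart v r₂ increasing₂ lowerBound₂
  where open Valid V
... | above a₁ ↑₁ | above a₂ ↑₂ with valid-shrink 0 V ↭-refl ↑₁ ↑₂ a₁ a₂
...   | refl , V′ = skip (valid⇒filling μ (suc v) _ _ V′)
valid⇒filling (c ∷ μ) v _ _ V | starts a₁ ↑₁ | above a₂ ↑₂ with valid-shrink 1 V ↭-refl ↑₁ ↑₂ a₁ a₂
...   | refl , V′ = top (valid⇒filling μ (suc v) _ _ V′)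
valid⇒filling (c ∷ μ) v r₁ (_ ∷ r₂) V | above a₁ ↑₁ | starts a₂ ↑₂
  with valid-shrink 1 V (shift v r₁ r₂) ↑₁ ↑₂ a₁ a₂
...   | refl , V′ = bottom (valid⇒filling μ (suc v) _ _ V′)
valid⇒filling (c ∷ μ) v (_ ∷ r₁) (_ ∷ r₂) V | starts a₁ ↑₁ | starts a₂ ↑₂
  with valid-shrink 2 V (prep v (shift v r₁ r₂)) ↑₁ ↑₂ a₁ a₂
...   | refl , V′ = both (valid⇒filling μ (suc v) _ _ V′)

tailVerdict : Bool → Maybe (ℕ × ℕ) → Bool
tailVerdict b nothing        = b
tailVerdict b (just (x , y)) = y <ᵇ x

inversionTail-verdict : ∀ b is js → inversionTail b is js ≡ tailVerdict b (firstDiff is js)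
inversionTail-verdict b is js with firstDiff is js
... | nothing = refl
... | just _  = refl

data FirstDifference (as bs : List ℕ) : Set where
  none    : firstDiff as bs ≡ nothing → firstDiff bs as ≡ nothing →
            firstGT (zipWith comparison as bs) ≡ false → FirstDifference as bs
  less    : ∀ {x y} → x < y → firstDiff as bs ≡ just (x , y) → firstDiff bs as ≡ just (y , x) →
            firstGT (zipWith comparison as bs) ≡ false → FirstDifference as bs
  greater : ∀ {x y} → y < x → firstDiff as bs ≡ just (x , y) → firstDiff bs as ≡ just (y , x) →
            firstGT (zipWith comparison as bs) ≡ true → FirstDifference as bs

firstDiff-≡ : ∀ x as bs → firstDiff (x ∷ as) (x ∷ bs) ≡ firstDiff as bs
firstDiff-≡ x as bs rewrite ≟-diag (refl {x = x}) = refl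

firstDiff-≢ : ∀ {x y} as bs → x ≢ y → firstDiff (x ∷ as) (y ∷ bs) ≡ just (x , y)
firstDiff-≢ as bs x≢y rewrite ≢-≟-identity _≟_ x≢y = refl

firstGT-≡ : ∀ x as bs → firstGT (zipWith comparison (x ∷ as) (x ∷ bs)) ≡ firstGT (zipWith comparison as bs)
firstGT-≡ x as bs rewrite comparison-≡ x = refl

firstDifference-∷ : ∀ x {as bs} → FirstDifference as bs → FirstDifference (x ∷ as) (x ∷ bs)
firstDifference-∷ x {as} {bs} (none e₁ e₂ e₃) =
  none (trans (firstDiff-≡ x as bs) e₁) (trans (firstDiff-≡ x bs as) e₂) (trans (firstGT-≡ x as bs) e₃)
firstDifference-∷ x {as} {bs} (less x<y e₁ e₂ e₃) =
  less x<y (trans (firstDiff-≡ x as bs) e₁) (trans (firstDiff-≡ x bs as) e₂) (trans (firstGT-≡ x as bs) e₃)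
firstDifference-∷ x {as} {bs} (greater y<x e₁ e₂ e₃) =
  greater y<x (trans (firstDiff-≡ x as bs) e₁) (trans (firstDiff-≡ x bs as) e₂) (trans (firstGT-≡ x as bs) e₃)

firstDifference : ∀ as bs → FirstDifference as bs
firstDifference []       []       = none refl refl refl
firstDifference []       (_ ∷ _)  = none refl refl refl
firstDifference (_ ∷ _)  []       = none refl refl refl
firstDifference (x ∷ as) (y ∷ bs) with <-cmp x y
... | tri< x<y _ _ = less x<y (firstDiff-≢ as bs (<⇒≢ x<y)) (firstDiff-≢ bs as (>⇒≢ x<y))
                          (cong (λ c → firstGT (c ∷ zipWith comparison as bs)) (comparison-< x<y))
... | tri> _ _ y<x = greater y<x (firstDiff-≢ as bs (>⇒≢ y<x)) (firstDiff-≢ bs as (<⇒≢ y<x))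
                             (cong (λ c → firstGT (c ∷ zipWith comparison as bs)) (comparison-> y<x))
... | tri≈ _ refl _ = firstDifference-∷ x (firstDifference as bs)

columnInversion-comparison : ∀ a b as bs →
  (if columnInversion a as b bs then 1 else 0) ≡ columnInversions (comparison a b) (firstGT (zipWith comparison as bs))
columnInversion-comparison a b as bs with a <ᵇ b
... | true rewrite inversionTail-verdict false as bs with firstDifference as bs
...   | none e₁ _ e₃          rewrite e₁ | e₃ = refl
...   | less x<y e₁ _ e₃      rewrite e₁ | e₃ | ≥⇒<ᵇ≡false (<⇒≤ x<y) = refl
...   | greater y<x e₁ _ e₃   rewrite e₁ | e₃ | <⇒<ᵇ≡true y<x = refl
columnInversion-comparison a b as bs | false with b <ᵇ a
... | false = refl
... | true rewrite inversionTail-verdict true bs as with firstDifference as bs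
...   | none _ e₂ e₃          rewrite e₂ | e₃ = refl
...   | less x<y _ e₂ e₃      rewrite e₂ | e₃ | <⇒<ᵇ≡true x<y = refl
...   | greater y<x _ e₂ e₃   rewrite e₂ | e₃ | ≥⇒<ᵇ≡false (<⇒≤ y<x) = refl

ninvRows-inversions : ∀ {n} (r₁ r₂ : Vec ℕ n) →
  ninvRows r₁ r₂ ≡ inversions (zipWith comparison (toList r₁) (toList r₂))
ninvRows-inversions []       []       = refl
ninvRows-inversions (a ∷ as) (b ∷ bs) =
  cong₂ _+_ (columnInversion-comparison a b (toList as) (toList bs)) (ninvRows-inversions as bs)

-- Tableaux as coloured paths

Σ-≡-irrelevant : ∀ {A : Set} {B : A → Set} → (∀ a (x y : B a) → x ≡ y) →
  ∀ {a a′} {b : B a} {b′ : B a′} → a ≡ a′ → _≡_ {A = Σ A B} (a , b) (a′ , b′)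
Σ-≡-irrelevant irr {b = b} {b′} refl = cong (_ ,_) (irr _ b b′)

rowVec : ∀ {n} (xs : List ℕ) → length xs ≡ n → Vec ℕ n
rowVec xs l = cast l (fromList xs)

toList-rowVec : ∀ {n} xs (l : length xs ≡ n) → toList (rowVec xs l) ≡ xs
toList-rowVec xs l = trans (toList-cast l (fromList xs)) (toList∘fromList xs)

multiplicities-applyUpTo : ∀ {xs} v K (g : ℕ → ℕ) → (∀ j → g j ≡ v + j) →
  multiplicities v K xs ≡ map (λ k → countEq k xs) (applyUpTo g K)
multiplicities-applyUpTo v zero    g g≗ = refl
multiplicities-applyUpTo {xs} v (suc K) g g≗ =
  cong₂ _∷_ (cong (λ k → countEq k xs) (sym (trans (g≗ 0) (+-identityʳ v))))
            (multiplicities-applyUpTo (suc v) K (g ∘ suc) (λ j → trans (g≗ (suc j)) (+-suc v j)))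

multiplicities-oneTo : ∀ K xs → multiplicities 1 K xs ≡ map (λ k → countEq k xs) (oneTo K)
multiplicities-oneTo K xs = multiplicities-applyUpTo 1 K suc (λ _ → refl)

ninv-inversions : ∀ {n} (v₁ v₂ : Vec ℕ n) → ninv (v₁ , v₂) ≡ inversions (columns (toList v₁) (toList v₂))
ninv-inversions v₁ v₂ = trans (ninvRows-inversions v₁ v₂)
  (cong inversions (sym (columns-same-length (toList v₁) (toList v₂) (trans (length-toList v₁) (sym (length-toList v₂))))))

ValidRows : List ℕ → ℕ → List ℕ → List ℕ → Set
ValidRows μ i r₁ r₂ = Valid μ 1 r₁ r₂ × inversions (columns r₁ r₂) ≡ i

TableauConditions : ∀ {n} → List ℕ → ℕ → Tableau n → Set
TableauConditions μ i τ = RowStandard τ × HasContent τ μ × ninv τ ≡ i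

tableau⇒validRows : ∀ {n μ i} (v₁ v₂ : Vec ℕ n) →
  TableauConditions μ i (v₁ , v₂) → ValidRows μ i (toList v₁) (toList v₂)
tableau⇒validRows {μ = μ} v₁ v₂ ((low₁ , low₂ , ↑₁ , ↑₂) , (content , bound) , e) = record
  { increasing₁ = ↑₁ ; increasing₂ = ↑₂ ; lowerBound₁ = low₁ ; lowerBound₂ = low₂
  ; content = trans (multiplicities-oneTo (length μ) _) content
  ; upperBound = All.map s≤s bound
  } , trans (sym (ninv-inversions v₁ v₂)) e

validRows⇒tableau : ∀ {n μ i} (v₁ v₂ : Vec ℕ n) →
  ValidRows μ i (toList v₁) (toList v₂) → TableauConditions μ i (v₁ , v₂)
validRows⇒tableau {μ = μ} v₁ v₂ (V , e) =
  (lowerBound₁ , lowerBound₂ , increasing₁ , increasing₂) ,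
  (trans (sym (multiplicities-oneTo (length μ) _)) content , All.map (λ { (s≤s x≤K) → x≤K }) upperBound) ,
  trans (ninv-inversions v₁ v₂) e
  where open Valid V

Admissible : ℕ → ℕ → ∀ {μ} → Rows μ 1 → Set
Admissible n i (r₁ , r₂ , _) = (length r₁ ≡ n) × (length r₂ ≡ n) × (inversions (columns r₁ r₂) ≡ i)

admissible-irrelevant : ∀ n i {μ} (rows : Rows μ 1) (x y : Admissible n i rows) → x ≡ y
admissible-irrelevant n i _ (a , b , c) (a′ , b′ , c′) = cong₂ _,_ (uip a a′) (cong₂ _,_ (uip b b′) (uip c c′))

tableauConditions-irrelevant : ∀ {n} μ i (τ : Tableau n) (x y : TableauConditions μ i τ) → x ≡ y
tableauConditions-irrelevant μ i τ
  ((a₁ , a₂ , l₁ , l₂) , (c , b) , e) ((a₁′ , a₂′ , l₁′ , l₂′) , (c′ , b′) , e′) =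
  cong₂ _,_ (cong₂ _,_ (All.irrelevant ≤-irrelevant a₁ a₁′) (cong₂ _,_ (All.irrelevant ≤-irrelevant a₂ a₂′)
                       (cong₂ _,_ (Linked.irrelevant <-irrelevant l₁ l₁′) (Linked.irrelevant <-irrelevant l₂ l₂′))))
            (cong₂ _,_ (cong₂ _,_ (uip c c′) (All.irrelevant ≤-irrelevant b b′)) (uip e e′))

rows-≡ : ∀ {μ v r₁ r₁′ r₂ r₂′} {f : Filling μ v r₁ r₂} {f′ : Filling μ v r₁′ r₂′} →
  r₁ ≡ r₁′ → r₂ ≡ r₂′ → _≡_ {A = Rows μ v} (r₁ , r₂ , f) (r₁′ , r₂′ , f′)
rows-≡ {f = f} {f′} refl refl = cong (λ f″ → _ , _ , f″) (filling-unique f f′)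

S-↔ : ∀ n μ i → S n μ i ↔ Σ (Rows μ 1) (Admissible n i)
S-↔ n μ i = mk↔ₛ′ to from to∘from from∘to
  where
  to : S n μ i → Σ (Rows μ 1) (Admissible n i)
  to ((v₁ , v₂) , w) with tableau⇒validRows v₁ v₂ w
  ... | V , e = (toList v₁ , toList v₂ , valid⇒filling μ 1 _ _ V) , length-toList v₁ , length-toList v₂ , e
  from : Σ (Rows μ 1) (Admissible n i) → S n μ i
  from ((r₁ , r₂ , f) , l₁ , l₂ , e) = (rowVec r₁ l₁ , rowVec r₂ l₂) ,
    validRows⇒tableau _ _
      (subst₂ (ValidRows μ i) (sym (toList-rowVec r₁ l₁)) (sym (toList-rowVec r₂ l₂)) (filling⇒valid f , e))
  to∘from : ∀ y → to (from y) ≡ y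
  to∘from ((r₁ , r₂ , f) , l₁ , l₂ , e) =
    Σ-≡-irrelevant (admissible-irrelevant n i) (rows-≡ (toList-rowVec r₁ l₁) (toList-rowVec r₂ l₂))
  from∘to : ∀ x → from (to x) ≡ x
  from∘to ((v₁ , v₂) , w) =
    Σ-≡-irrelevant (tableauConditions-irrelevant μ i) (cong₂ _,_ (fromList∘toList v₁) (fromList∘toList v₂))

equal-summands : ∀ {p q n} → p ≡ q → p + q ≡ 2 * n → p ≡ n
equal-summands {p} {q} {n} p≡q total =
  *-cancelˡ-≡ p n 2 (trans (cong (p +_) (+-identityʳ p)) (trans (cong (p +_) p≡q) total))

module _ {n μ m} (a : All (_≤ 2) μ) (sum≡ : sum μ ≡ 2 * n) (ones≡ : countEq 1 μ ≡ 2 * (n ∸ m)) (i : ℕ) where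

  private
    k = n ∸ m

    rows : PathOfSize (countEq 1 μ) → Rows μ 1
    rows = fromPath μ 1 a

    r₁ r₂ : PathOfSize (countEq 1 μ) → List ℕ
    r₁ q = proj₁ (rows q)
    r₂ q = proj₁ (proj₂ (rows q))

    records : ∀ q → Records (proj₁ q) (length (r₁ q)) (length (r₂ q)) (columns (r₁ q) (r₂ q))
    records q = subst (λ q′ → Records (proj₁ q′) (length (r₁ q)) (length (r₂ q)) (columns (r₁ q) (r₂ q)))
                      (toPath-fromPath μ 1 a q) (toPath-records (proj₂ (proj₂ (rows q))))

    lengths : ∀ q → length (r₁ q) + length (r₂ q) ≡ 2 * n
    lengths q = trans (filling-length (proj₂ (proj₂ (rows q)))) sum≡

    closedSize : size (0 , k , false , i) ≡ countEq 1 μ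
    closedSize = sym ones≡

    longer-≢ : ∀ h → n ≢ suc h + n
    longer-≢ h e = <-irrefl e (s≤s (m≤n+m n h))

  admissible⇒closed : ∀ q → Admissible n i (rows q) → Σ Bool λ σ → proj₁ q ≡ (0 , k , σ , i)
  admissible⇒closed q@((zero , v , σ , _) , e , _) (_ , _ , inv) with records q
  ... | _ , _ , i≡ = σ , cong₂ (λ v′ i′ → 0 , v′ , σ , i′) (*-cancelˡ-≡ v k 2 (trans e ones≡)) (trans i≡ inv)
  admissible⇒closed q@((suc h , _ , true , _) , _ , _) (l₁ , l₂ , _) with records q
  ... | longer , _ = ⊥-elim (longer-≢ h (trans (sym l₁) (trans longer (cong (suc h +_) l₂))))
  admissible⇒closed q@((suc h , _ , false , _) , _ , _) (l₁ , l₂ , _) with records q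
  ... | longer , _ = ⊥-elim (longer-≢ h (trans (sym l₂) (trans longer (cong (suc h +_) l₁))))

  closed⇒admissible : ∀ σ (p : ColouredPath 0 k σ i) → Admissible n i (rows ((0 , k , σ , i) , closedSize , p))
  closed⇒admissible σ p with records q | lengths q
    where q = (0 , k , σ , i) , closedSize , p
  ... | same , _ , i≡ | total = equal-summands same total , trans (sym same) (equal-summands same total) , sym i≡

  admissiblePaths-↔ : Σ (PathOfSize (countEq 1 μ)) (λ q → Admissible n i (rows q)) ↔ ClosedPath k i
  admissiblePaths-↔ = mk↔ₛ′ to from to∘from from∘to
    where
    to : Σ (PathOfSize (countEq 1 μ)) (λ q → Admissible n i (rows q)) → ClosedPath k i
    to (q , c) = proj₁ (admissible⇒closed q c) , subst Path (proj₂ (admissible⇒closed q c)) (proj₂ (proj₂ q))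
    from : ClosedPath k i → Σ (PathOfSize (countEq 1 μ)) (λ q → Admissible n i (rows q))
    from (σ , p) = ((0 , k , σ , i) , closedSize , p) , closed⇒admissible σ p
    to∘from : ∀ c → to (from c) ≡ c
    to∘from (σ , p) = same-state (admissible⇒closed _ (closed⇒admissible σ p))
      where
      same-state : (s : Σ Bool λ σ′ → _≡_ {A = State} (0 , k , σ , i) (0 , k , σ′ , i)) →
                   _≡_ {A = ClosedPath k i} (proj₁ s , subst Path (proj₂ s) p) (σ , p)
      same-state (_ , refl) = refl
    from∘to : ∀ x → from (to x) ≡ x
    from∘to ((s , e , p) , c) with admissible⇒closed (s , e , p) c
    ... | _ , refl = Σ-≡-irrelevant (λ q → admissible-irrelevant n i (rows q)) (PathOfSize-≡ _ closedSize e p)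

theorem3p2 : (n : ℕ) → n ≥ 1 → (μ : List ℕ) → sum μ ≡ 2 * n →
    (Any (2 <_) μ → ∀ i → HasCard (S n μ i) 0)
    × (∀ m → All (_≤ 2) μ → countEq 2 μ ≡ m → countEq 1 μ ≡ 2 * n ∸ 2 * m →
       ∀ i → HasCard (S n μ i) (catalanCompSum i (n ∸ m) + catalanCompSum (suc i) (n ∸ m)))
-- Neither n ≥ 1 nor the number m of doubled values is needed: the path has
-- countEq 1 μ = 2 (n − m) steps.
theorem3p2 n _ μ sum≡ = (λ triple i → card-empty (no-triple-entry μ i triple)) , count
  where
  count : ∀ m → All (_≤ 2) μ → countEq 2 μ ≡ m → countEq 1 μ ≡ 2 * n ∸ 2 * m →
          ∀ i → HasCard (S n μ i) (catalanCompSum i (n ∸ m) + catalanCompSum (suc i) (n ∸ m))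
  count m a _ ones≡ i = ↔-trans (closedPath-card i (n ∸ m)) (↔-sym (begin
    S n μ i                                                         ↔⟨ S-↔ n μ i ⟩
    Σ (Rows μ 1) (Admissible n i)                                   ↔⟨ ↔-sym (Σ-↔ (↔-sym (rows-↔ μ 1 a)) ↔-refl) ⟩
    Σ (PathOfSize (countEq 1 μ)) (λ q → Admissible n i (fromPath μ 1 a q))
      ↔⟨ admissiblePaths-↔ {m = m} a sum≡ (trans ones≡ (sym (*-distribˡ-∸ 2 n m))) i ⟩
    ClosedPath (n ∸ m) i                                            ∎))
    where open Related.EquationalReasoning
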